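{- Fix an integer $k>2$. For every integer $i\ge1$, every sequence of integers $4k^2\le x_0<x_1<\dots<x_i$ satisfying $d_i(x_0,x_i)=0$ is not min-homogeneous for $c$; that is, the set $\{x_0,\dots,x_i\}$ is not min-homogeneous for $c$.
   Context: For a function $f:\mathbb N\to\mathbb N$, $f^{(0)}(x)=x$ and $f^{(n+1)}(x)=f(f^{(n)}(x))$. Define $f_i:\mathbb N\to\mathbb N$ for $i\ge1$ by $f_1(n)=n+1$ and $f_{i+1}(n)=f_i^{(\lfloor\sqrt n/2\rfloor)}(n)$. With $k>2$ fixed, for $m,n\ge 4k^2$ and $i\ge1$ let $d_i(m,n)=|\{l\in\mathbb N: m<f_i^{(l)}(4k^2)\le n\}|$. For $n>m\ge 4k^2$, let $I(m,n)$ be the greatest $i\ge1$ for which $d_i(m,n)>0$, and $d(m,n)=d_{I(m,n)}(m,n)$. Let $\operatorname{Pr}(a,b)=\binom{a+b+1}{2}+b$. Define the coloring $c$ of $2$-element subsets of $\{n\in\mathbb N:n\ge4k^2\}$ by $c(\{m,n\})=\operatorname{Pr}(I(m,n),d(m,n))$ for $m<n$. A set $B$ is min-homogeneous for $c$ if for all $m<n$, $m<n'$ in $B$ one has $c(\{m,n\})=c(\{m,n'\})$. -}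

module Defs where

open import Data.Nat using (ℕ; zero; suc; _+_; _*_; _≤_; _<_; _≤ᵇ_; _<ᵇ_)
open import Data.Nat.Combinatorics using (_C_)
open import Data.Bool using (Bool; true; false; if_then_else_; _∧_)
open import Relation.Binary.PropositionalEquality using (_≡_)

iter : (ℕ → ℕ) → ℕ → ℕ → ℕ
iter f zero    x = x
iter f (suc n) x = f (iter f n x)

-- halfSqrt n = ⌊ √n / 2 ⌋ = the largest s with (2s)² ≤ n
halfSqrt : ℕ → ℕ
halfSqrt zero    = zero
halfSqrt (suc n) with halfSqrt n
... | s = if ((2 * suc s) * (2 * suc s)) ≤ᵇ suc n then suc s else s

-- f i = f_i for i ≥ 1 ; index 0 is an unused junk value (set equal to f_1)
f : ℕ → ℕ → ℕ
f zero          n = suc n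
f (suc zero)    n = suc n
f (suc (suc i)) n = iter (f (suc i)) (halfSqrt n) n

countBelow : (ℕ → Bool) → ℕ → ℕ
countBelow p zero    = zero
countBelow p (suc b) = (if p b then 1 else 0) + countBelow p b

base : ℕ → ℕ
base k = 4 * (k * k)

-- d_i(m,n) = |{ l ∈ ℕ : m < f_i^(l)(4k²) ≤ n }|.
-- Since f_i^(l)(4k²) ≥ 4k² + l > l, only l ≤ n can contribute, so
-- counting over l < n + 1 gives exactly this cardinality.
d : ℕ → ℕ → ℕ → ℕ → ℕ
d k i m n = countBelow (λ l → (m <ᵇ iter (f i) l (base k)) ∧ (iter (f i) l (base k) ≤ᵇ n)) (suc n)

greatestI : ℕ → ℕ → ℕ → ℕ → ℕ
greatestI k m n zero    = 1
greatestI k m n (suc j) = if 0 <ᵇ d k (suc j) m n then suc j else greatestI k m n j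

-- I(m,n): greatest i ≥ 1 with d_i(m,n) > 0.  Since f_i(4k²) ≥ 4k² + i,
-- d_i(m,n) = 0 whenever i > n, so searching i ∈ [1, n] suffices.
I : ℕ → ℕ → ℕ → ℕ
I k m n = greatestI k m n n

dI : ℕ → ℕ → ℕ → ℕ
dI k m n = d k (I k m n) m n

Pr : ℕ → ℕ → ℕ
Pr a b = (suc (a + b) C 2) + b

c : ℕ → ℕ → ℕ → ℕ
c k m n = Pr (I k m n) (dI k m n)

MinHomogeneous : ℕ → (ℕ → Set) → Set
MinHomogeneous k B = ∀ m n n' → B m → B n → B n' → m < n → m < n' → c k m n ≡ c k m n'

{-# OPTIONS --safe #-}
module Submission where

-- Let x₀ < … < xᵢ lie in a min-homogeneous set with no point of the f_i-orbit of 4k² in (x₀, xᵢ].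
-- The f₁-orbit contains every n ≥ 4k², so d₁(x₀, xᵢ) > 0 and R = I(x₀, xᵢ) satisfies d_R(x₀, xᵢ) > 0;
-- as f_{i+1}-orbits are suborbits of f_i-orbits, d_{i'}(x₀, xᵢ) = 0 for i' ≥ i, hence 1 ≤ R < i.
-- Equal colours c(x₀, x₁) = c(x₀, xᵢ) and injectivity of the pairing Pr give d_R(x₀, x₁) = d_R(x₀, xᵢ),
-- and by additivity of d_R over adjacent intervals no f_R-orbit point lies in (x₁, xᵢ]. Thus
-- x₁ < … < x_{R+1} is a shorter chain of the same kind; well-founded induction on i ends at i = 1.

open import Defs
open import Data.Nat using (ℕ; _≤_; _<_; _*_)
open import Data.Fin using (Fin; zero; fromℕ; toℕ)
open import Data.Product using (∃)
open import Relation.Nullary using (¬_)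
open import Relation.Binary.PropositionalEquality using (_≡_)

open import Data.Nat using (zero; suc; _+_; _∸_; _≤ᵇ_; _<ᵇ_; _≤′_; ≤′-refl; ≤′-step; z≤n; s≤s; z<s)
open import Data.Nat.Properties
open import Data.Nat.Combinatorics using (_C_; nCk+nC[k+1]≡[n+1]C[k+1]; nC1≡n)
open import Data.Nat.Induction using (<-wellFounded)
open import Induction.WellFounded using (Acc; acc)
open import Data.Bool using (Bool; true; false; if_then_else_; T)
import Data.Fin as Fin
open import Data.Fin.Properties using (toℕ-inject≤; toℕ-injective; ≤fromℕ)
open import Data.Product using (_×_; _,_)
open import Data.Sum using (inj₁; inj₂)
open import Function using (case_of_)
open import Relation.Nullary using (Dec; does; contradiction)
open import Relation.Nullary.Decidable using (_×-dec_; dec-true; dec-false)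
open import Relation.Binary.Core using (_Preserves_⟶_)
open import Relation.Binary.Definitions using (tri<; tri≈; tri>)
open import Relation.Binary.PropositionalEquality using (refl; sym; trans; cong; cong₂; subst; subst₂; module ≡-Reasoning)
open import Algebra.Properties.CommutativeSemigroup +-commutativeSemigroup using (interchange)

iter-+ : ∀ g a b x → iter g (a + b) x ≡ iter g a (iter g b x)
iter-+ g zero    b x = refl
iter-+ g (suc a) b x = cong g (iter-+ g a b x)

iter-suc : ∀ l x → iter suc l x ≡ l + x
iter-suc zero    x = refl
iter-suc (suc l) x = cong suc (iter-suc l x)

+≤iter : ∀ {g t} → (∀ y → t ≤ y → y < g y) → ∀ l x → t ≤ x → x + l ≤ iter g l x
+≤iter         expanding zero    x t≤x = ≤-reflexive (+-identityʳ x)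
+≤iter {g} {t} expanding (suc l) x t≤x = subst (_≤ iter g (suc l) x) (sym (+-suc x l))
  (≤-<-trans IH (expanding _ (≤-trans t≤x (≤-trans (m≤m+n x l) IH))))
  where
  IH : x + l ≤ iter g l x
  IH = +≤iter expanding l x t≤x

iter-suborbit : ∀ {g g′} → (∀ y → ∃ λ h → g′ y ≡ iter g h y) →
                ∀ l x → ∃ λ l′ → iter g′ l x ≡ iter g l′ x
iter-suborbit step zero x = zero , refl
iter-suborbit {g} {g′} step (suc l) x with iter-suborbit step l x
... | l′ , e with step (iter g l′ x)
...   | h , e′ = h + l′ , (begin
  g′ (iter g′ l x)        ≡⟨ cong g′ e ⟩
  g′ (iter g l′ x)        ≡⟨ e′ ⟩
  iter g h (iter g l′ x)  ≡⟨ sym (iter-+ g h l′ x) ⟩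
  iter g (h + l′) x       ∎)
  where open ≡-Reasoning

halfSqrt-≤-suc : ∀ n → halfSqrt n ≤ halfSqrt (suc n)
halfSqrt-≤-suc n with halfSqrt n
... | s with (2 * suc s) * (2 * suc s) ≤ᵇ suc n
...   | true  = n≤1+n s
...   | false = ≤-refl

halfSqrt-mono′ : ∀ {m n} → m ≤′ n → halfSqrt m ≤ halfSqrt n
halfSqrt-mono′ ≤′-refl = ≤-refl
halfSqrt-mono′ {n = suc n} (≤′-step m≤n) = ≤-trans (halfSqrt-mono′ m≤n) (halfSqrt-≤-suc n)

1≤halfSqrt : ∀ {n} → 4 ≤ n → 1 ≤ halfSqrt n
1≤halfSqrt 4≤n = halfSqrt-mono′ (≤⇒≤′ 4≤n)

f-expanding : ∀ i y → 4 ≤ y → y < f i y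
f-expanding zero          y _   = ≤-refl
f-expanding (suc zero)    y _   = ≤-refl
f-expanding (suc (suc i)) y 4≤y =
  <-≤-trans (m<m+n y (1≤halfSqrt 4≤y)) (+≤iter (f-expanding (suc i)) (halfSqrt y) y 4≤y)

f-suc-iterates : ∀ i y → ∃ λ h → f (suc i) y ≡ iter (f i) h y
f-suc-iterates zero    y = 1 , refl
f-suc-iterates (suc i) y = halfSqrt y , refl

orbit : ℕ → ℕ → ℕ → ℕ
orbit k i l = iter (f i) l (base k)

orbit-suc-suborbit : ∀ k i l → ∃ λ l′ → orbit k (suc i) l ≡ orbit k i l′
orbit-suc-suborbit k i l = iter-suborbit (f-suc-iterates i) l (base k)

orbit-inflationary : ∀ k → 4 ≤ base k → ∀ i l → l ≤ orbit k i l
orbit-inflationary k 4≤base i l =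
  ≤-trans (m≤n+m l (base k)) (+≤iter (f-expanding i) l (base k) 4≤base)

orbit-f₁ : ∀ k l → orbit k 1 l ≡ l + base k
orbit-f₁ k l = iter-suc l (base k)

indicator : Bool → ℕ
indicator b = if b then 1 else 0

countBelow-≡0 : ∀ p b → countBelow p b ≡ 0 → ∀ {l} → l < b → p l ≡ false
countBelow-≡0 p (suc b) count≡0 l<1+b with p b in pb≡
... | true  = case count≡0 of λ ()
... | false with m<1+n⇒m<n∨m≡n l<1+b
...   | inj₁ l<b  = countBelow-≡0 p b count≡0 l<b
...   | inj₂ refl = pb≡

countBelow-false : ∀ p b → (∀ l → p l ≡ false) → countBelow p b ≡ 0
countBelow-false p zero    p≡false = refl
countBelow-false p (suc b) p≡false rewrite p≡false b = countBelow-false p b p≡false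

countBelow-pad : ∀ p {b b′} → b ≤ b′ → (∀ l → b ≤ l → p l ≡ false) → countBelow p b′ ≡ countBelow p b
countBelow-pad p {b′ = zero}   z≤n _ = refl
countBelow-pad p {b′ = suc b′} b≤1+b′ p≡false with m≤n⇒m<n∨m≡n b≤1+b′
... | inj₂ refl       = refl
... | inj₁ (s≤s b≤b′) rewrite p≡false b′ b≤b′ = countBelow-pad p b≤b′ p≡false

countBelow-+ : ∀ p q r b → (∀ l → indicator (p l) ≡ indicator (q l) + indicator (r l)) →
               countBelow p b ≡ countBelow q b + countBelow r b
countBelow-+ p q r zero    split = refl
countBelow-+ p q r (suc b) split = begin
  indicator (p b) + countBelow p b
    ≡⟨ cong₂ _+_ (split b) (countBelow-+ p q r b split) ⟩
  (indicator (q b) + indicator (r b)) + (countBelow q b + countBelow r b)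
    ≡⟨ interchange (indicator (q b)) (indicator (r b)) (countBelow q b) (countBelow r b) ⟩
  (indicator (q b) + countBelow q b) + (indicator (r b) + countBelow r b) ∎
  where open ≡-Reasoning

does≡false⇒¬ : ∀ {A : Set} (a? : Dec A) → does a? ≡ false → ¬ A
does≡false⇒¬ a? does≡false a = case trans (sym (dec-true a? a)) does≡false of λ ()

between? : ∀ m n v → Dec (m < v × v ≤ n)
between? m n v = m <? v ×-dec v ≤? n

between-split : ∀ {m n p} → m ≤ n → n ≤ p → ∀ v →
  indicator (does (between? m p v)) ≡ indicator (does (between? m n v)) + indicator (does (between? n p v))
between-split {m} {n} {p} m≤n n≤p v with ≤-<-connex v n
... | inj₁ v≤n with ≤-<-connex v m
...   | inj₁ v≤m
  rewrite dec-false (between? m p v) (λ (m<v , _) → <⇒≱ m<v v≤m)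
        | dec-false (between? m n v) (λ (m<v , _) → <⇒≱ m<v v≤m)
        | dec-false (between? n p v) (λ (n<v , _) → <⇒≱ n<v v≤n) = refl
...   | inj₂ m<v
  rewrite dec-true  (between? m p v) (m<v , ≤-trans v≤n n≤p)
        | dec-true  (between? m n v) (m<v , v≤n)
        | dec-false (between? n p v) (λ (n<v , _) → <⇒≱ n<v v≤n) = refl
between-split {m} {n} {p} m≤n n≤p v | inj₂ n<v with ≤-<-connex v p
...   | inj₁ v≤p
  rewrite dec-true  (between? m p v) (≤-<-trans m≤n n<v , v≤p)
        | dec-false (between? m n v) (λ (_ , v≤n) → <⇒≱ n<v v≤n)
        | dec-true  (between? n p v) (n<v , v≤p) = refl
...   | inj₂ p<v
  rewrite dec-false (between? m p v) (λ (_ , v≤p) → <⇒≱ p<v v≤p)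
        | dec-false (between? m n v) (λ (_ , v≤n) → <⇒≱ n<v v≤n)
        | dec-false (between? n p v) (λ (_ , v≤p) → <⇒≱ p<v v≤p) = refl

-- d k i m n is definitionally countBetween (orbit k i) m n (suc n).
countBetween : (ℕ → ℕ) → ℕ → ℕ → ℕ → ℕ
countBetween q m n = countBelow (λ l → does (between? m n (q l)))

Avoids : (ℕ → ℕ) → ℕ → ℕ → Set
Avoids q m n = ∀ l → ¬ (m < q l × q l ≤ n)

module _ {q : ℕ → ℕ} where

  countBetween-split : ∀ {m n p} → m ≤ n → n ≤ p → ∀ b →
    countBetween q m p b ≡ countBetween q m n b + countBetween q n p b
  countBetween-split m≤n n≤p b = countBelow-+ _ _ _ b (λ l → between-split m≤n n≤p (q l))

  countBetween-pad : (∀ l → l ≤ q l) → ∀ {m n b} → n < b →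
    countBetween q m n b ≡ countBetween q m n (suc n)
  countBetween-pad inflationary n<b = countBelow-pad _ n<b
    (λ l n<l → dec-false (between? _ _ (q l)) (λ (_ , ql≤n) → <⇒≱ n<l (≤-trans (inflationary l) ql≤n)))

  countBetween-≡0⇒Avoids : (∀ l → l ≤ q l) → ∀ {m n} → countBetween q m n (suc n) ≡ 0 → Avoids q m n
  countBetween-≡0⇒Avoids inflationary count≡0 l m<ql≤n@(_ , ql≤n) =
    does≡false⇒¬ (between? _ _ (q l))
      (countBelow-≡0 _ _ count≡0 (s≤s (≤-trans (inflationary l) ql≤n))) m<ql≤n

  Avoids⇒countBetween≡0 : ∀ {m n} → Avoids q m n → ∀ b → countBetween q m n b ≡ 0
  Avoids⇒countBetween≡0 avoids b = countBelow-false _ b (λ l → dec-false (between? _ _ (q l)) (avoids l))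

  Avoids-shrink : ∀ {m n n′} → n′ ≤ n → Avoids q m n → Avoids q m n′
  Avoids-shrink n′≤n avoids l (m<ql , ql≤n′) = avoids l (m<ql , ≤-trans ql≤n′ n′≤n)

Avoids-suborbit : ∀ {q q′} → (∀ l → ∃ λ l′ → q′ l ≡ q l′) → ∀ {m n} → Avoids q m n → Avoids q′ m n
Avoids-suborbit sub avoids l with sub l
... | l′ , q′l≡ rewrite q′l≡ = avoids l′

Avoids-mono′ : ∀ {k i i′ m n} → i ≤′ i′ → Avoids (orbit k i) m n → Avoids (orbit k i′) m n
Avoids-mono′ ≤′-refl avoids = avoids
Avoids-mono′ {k} {i′ = suc i′} (≤′-step i≤i′) avoids =
  Avoids-suborbit (orbit-suc-suborbit k i′) (Avoids-mono′ {k} i≤i′ avoids)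

1≤greatestI : ∀ k m n j → 1 ≤ greatestI k m n j
1≤greatestI k m n zero    = s≤s z≤n
1≤greatestI k m n (suc j) with 0 <ᵇ d k (suc j) m n
... | true  = s≤s z≤n
... | false = 1≤greatestI k m n j

greatestI-positive : ∀ k m n j → 0 < d k 1 m n → 0 < d k (greatestI k m n j) m n
greatestI-positive k m n zero    d₁>0 = d₁>0
greatestI-positive k m n (suc j) d₁>0 with 0 <ᵇ d k (suc j) m n in d>ᵇ0
... | true  = <ᵇ⇒< 0 _ (subst T (sym d>ᵇ0) _)
... | false = greatestI-positive k m n j d₁>0

module _ {k : ℕ} (4≤base : 4 ≤ base k) where

  d≡0⇒Avoids : ∀ {i m n} → d k i m n ≡ 0 → Avoids (orbit k i) m n
  d≡0⇒Avoids {i} = countBetween-≡0⇒Avoids (orbit-inflationary k 4≤base i)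

  d-split : ∀ {i m n p} → m ≤ n → n ≤ p → d k i m p ≡ d k i m n + d k i n p
  d-split {i} {m} {n} {p} m≤n n≤p = begin
    d k i m p
      ≡⟨ countBetween-split {orbit k i} m≤n n≤p (suc p) ⟩
    countBetween (orbit k i) m n (suc p) + d k i n p
      ≡⟨ cong (_+ d k i n p) (countBetween-pad (orbit-inflationary k 4≤base i) (s≤s n≤p)) ⟩
    d k i m n + d k i n p ∎
    where open ≡-Reasoning

  d₁-positive : ∀ {m n} → base k ≤ m → m < n → 0 < d k 1 m n
  d₁-positive {m} {n} base≤m m<n = n≢0⇒n>0 λ d≡0 →
    d≡0⇒Avoids {1} d≡0 (n ∸ base k) (subst (m <_) (sym n-hit) m<n , ≤-reflexive n-hit)
    where
    n-hit : orbit k 1 (n ∸ base k) ≡ n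
    n-hit = trans (orbit-f₁ k (n ∸ base k)) (m∸n+n≡m (≤-trans base≤m (<⇒≤ m<n)))

  I<i : ∀ {i m n} → base k ≤ m → m < n → Avoids (orbit k i) m n → I k m n < i
  I<i {i} {m} {n} base≤m m<n avoids = ≰⇒> λ i≤I →
    <⇒≢ (greatestI-positive k m n n (d₁-positive base≤m m<n))
        (sym (Avoids⇒countBetween≡0 (Avoids-mono′ {k} (≤⇒≤′ i≤I) avoids) (suc n)))

triangle : ℕ → ℕ
triangle s = suc s C 2

triangle-suc : ∀ s → triangle (suc s) ≡ suc s + triangle s
triangle-suc s = trans (sym (nCk+nC[k+1]≡[n+1]C[k+1] (suc s) 1)) (cong (_+ triangle s) (nC1≡n (suc s)))

triangle-mono′ : ∀ {s s′} → s ≤′ s′ → triangle s ≤ triangle s′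
triangle-mono′ ≤′-refl = ≤-refl
triangle-mono′ {s} {suc s′} (≤′-step s≤s′) = begin
  triangle s              ≤⟨ triangle-mono′ s≤s′ ⟩
  triangle s′             ≤⟨ m≤n+m (triangle s′) (suc s′) ⟩
  suc s′ + triangle s′    ≡⟨ triangle-suc s′ ⟨
  triangle (suc s′)       ∎
  where open ≤-Reasoning

Pr-< : ∀ a b a′ b′ → a + b < a′ + b′ → Pr a b < Pr a′ b′
Pr-< a b a′ b′ s<s′ = begin-strict
  triangle (a + b) + b              ≤⟨ +-monoʳ-≤ (triangle (a + b)) (m≤n+m b a) ⟩
  triangle (a + b) + (a + b)        <⟨ n<1+n _ ⟩
  suc (triangle (a + b) + (a + b))  ≡⟨ cong suc (+-comm (triangle (a + b)) (a + b)) ⟩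
  suc (a + b) + triangle (a + b)    ≡⟨ sym (triangle-suc (a + b)) ⟩
  triangle (suc (a + b))            ≤⟨ triangle-mono′ (≤⇒≤′ s<s′) ⟩
  triangle (a′ + b′)                ≤⟨ m≤m+n (triangle (a′ + b′)) b′ ⟩
  triangle (a′ + b′) + b′           ∎
  where open ≤-Reasoning

Pr-injective : ∀ a b a′ b′ → Pr a b ≡ Pr a′ b′ → a ≡ a′ × b ≡ b′
Pr-injective a b a′ b′ Pr≡ with <-cmp (a + b) (a′ + b′)
... | tri< s<s′ _ _ = contradiction Pr≡ (<⇒≢ (Pr-< a b a′ b′ s<s′))
... | tri> _ _ s>s′ = contradiction Pr≡ (>⇒≢ (Pr-< a′ b′ a b s>s′))
... | tri≈ _ s≡s′ _ = a≡a′ , b≡b′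
  where
  b≡b′ : b ≡ b′
  b≡b′ = +-cancelˡ-≡ (triangle (a + b)) b b′ (trans Pr≡ (cong (λ s → triangle s + b′) (sym s≡s′)))
  a≡a′ : a ≡ a′
  a≡a′ = +-cancelʳ-≡ b a a′ (trans s≡s′ (cong (a′ +_) (sym b≡b′)))

c≡⇒d≡ : ∀ k m n n′ → c k m n ≡ c k m n′ → d k (I k m n′) m n ≡ d k (I k m n′) m n′
c≡⇒d≡ k m n n′ c≡ with Pr-injective (I k m n) (dI k m n) (I k m n′) (dI k m n′) c≡
... | I≡ , dI≡ = subst (λ i → d k i m n ≡ d k (I k m n′) m n′) I≡ dI≡

strictMono⇒mono : ∀ {n} {x : Fin n → ℕ} → x Preserves Fin._<_ ⟶ _<_ → x Preserves Fin._≤_ ⟶ _≤_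
strictMono⇒mono {x = x} x↑ j≤j′ with m≤n⇒m<n∨m≡n j≤j′
... | inj₁ j<j′ = <⇒≤ (x↑ j<j′)
... | inj₂ j≡j′ = ≤-reflexive (cong x (toℕ-injective j≡j′))

module _ {k : ℕ} (4≤base : 4 ≤ base k) {B : ℕ → Set} (homogeneous : MinHomogeneous k B) where

  no-chain-across-orbit-gap : ∀ {i} → Acc _<_ i → 1 ≤ i → (x : Fin (suc i) → ℕ) → (∀ j → B (x j)) →
    x Preserves Fin._<_ ⟶ _<_ → base k ≤ x zero → ¬ Avoids (orbit k i) (x zero) (x (fromℕ i))
  no-chain-across-orbit-gap {suc n} (acc smaller) _ x x∈B x↑ base≤x₀ avoids =
    no-chain-across-orbit-gap (smaller R<i) (1≤greatestI k x₀ xᵢ xᵢ) x′ (λ _ → x∈B _) x′↑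
      (≤-trans base≤x₀ (<⇒≤ x₀<x₁)) (Avoids-shrink (x↗ (≤fromℕ _)) avoids₁)
    where
    x₀ x₁ xᵢ : ℕ
    x₀ = x zero
    x₁ = x (Fin.suc zero)
    xᵢ = x (fromℕ (suc n))
    x↗ : x Preserves Fin._≤_ ⟶ _≤_
    x↗ = strictMono⇒mono x↑
    x₀<x₁ : x₀ < x₁
    x₀<x₁ = x↑ z<s
    x₀<xᵢ : x₀ < xᵢ
    x₀<xᵢ = x↑ z<s
    R : ℕ
    R = I k x₀ xᵢ
    R<i : R < suc n
    R<i = I<i {k} 4≤base base≤x₀ x₀<xᵢ avoids
    same-colour : c k x₀ x₁ ≡ c k x₀ xᵢ
    same-colour = homogeneous x₀ x₁ xᵢ (x∈B _) (x∈B _) (x∈B _) x₀<x₁ x₀<xᵢ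
    avoids₁ : Avoids (orbit k R) x₁ xᵢ
    avoids₁ = d≡0⇒Avoids {k} 4≤base {R} (+-cancelˡ-≡ (d k R x₀ x₁) _ 0 (begin
      d k R x₀ x₁ + d k R x₁ xᵢ  ≡⟨ d-split {k} 4≤base {R} (<⇒≤ x₀<x₁) (x↗ (≤fromℕ _)) ⟨
      d k R x₀ xᵢ                ≡⟨ c≡⇒d≡ k x₀ x₁ xᵢ same-colour ⟨
      d k R x₀ x₁                ≡⟨ +-identityʳ _ ⟨
      d k R x₀ x₁ + 0            ∎))
      where open ≡-Reasoning
    x′ : Fin (suc R) → ℕ
    x′ j = x (Fin.suc (Fin.inject≤ j R<i))
    x′↑ : x′ Preserves Fin._<_ ⟶ _<_
    x′↑ {j} {j′} j<j′ = x↑ (s≤s (subst₂ _<_ (sym (toℕ-inject≤ j R<i)) (sym (toℕ-inject≤ j′ R<i)) j<j′))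

4≤base : ∀ {k} → 1 ≤ k → 4 ≤ base k
4≤base 1≤k = *-monoʳ-≤ 4 (*-mono-≤ 1≤k 1≤k)

mainTheorem3 : (k : ℕ) → 2 < k → (i : ℕ) → 1 ≤ i → (x : Fin (ℕ.suc i) → ℕ) →
    4 * (k * k) ≤ x zero → (∀ j j' → toℕ j < toℕ j' → x j < x j') →
    d k i (x zero) (x (fromℕ i)) ≡ 0 →
    ¬ MinHomogeneous k (λ y → ∃ λ j → x j ≡ y)
mainTheorem3 k 2<k i 1≤i x base≤x₀ x↑ d≡0 homogeneous =
  no-chain-across-orbit-gap 4≤base′ homogeneous (<-wellFounded i) 1≤i x (λ j → j , refl)
    (λ {j} {j′} → x↑ j j′) base≤x₀ (d≡0⇒Avoids {k} 4≤base′ {i} d≡0)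
  where
  4≤base′ : 4 ≤ base k
  4≤base′ = 4≤base (≤-trans (s≤s z≤n) 2<k)
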